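{- For $N\ge 0$ let $a_N$ be the number of tilings of the $3\times 4\times \tfrac{N}{3}$ box by $1\times2\times 2$ bricks when $N/3$ is a positive integer, $a_N=0$ when $N/3$ is not an integer, and $a_0=1$. Then $$\sum_{N\ge 0} a_N z^N=\frac{(1-2z^6)(1-24z^6+122z^{12}-120z^{18})}{(1-z^6)(1-54z^6+646z^{12}-2540z^{18}+2640z^{24})}=1+29z^6+1065z^{12}+41097z^{18}+\cdots.$$
   Context: A tiling of a $k\times m\times n$ box (made of $kmn$ unit cubes) by $t_1\times t_2\times t_3$ bricks is a set of non-overlapping axis-parallel boxes with integer corners, each congruent to the brick (i.e. of dimensions some permutation of $(t_1,t_2,t_3)$; all orientations may be mixed), whose union is the box. Tilings related by a symmetry of the box are counted separately. $N$ is the number of bricks used. -}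

module Defs where

open import Data.Bool using (Bool; true; false; _∧_; _∨_; if_then_else_)
open import Data.Nat using (ℕ; zero; suc; _+_; _*_; _∸_; _≤ᵇ_; _<ᵇ_; _≡ᵇ_; _%_; _/_)
open import Data.Integer as ℤ using (ℤ; +_)
open import Data.List using (List; []; _∷_; map; _++_; length; upTo; filterᵇ; concatMap; foldr)
open import Data.Bool.ListAction using (any; all)
open import Data.Product using (_×_; _,_)

-- Boxes in ℕ³: a box is (corner, dimensions); it occupies the unit cubes
-- [x, x+d₁) × [y, y+d₂) × [z, z+d₃).

Triple : Set
Triple = ℕ × ℕ × ℕ

Box : Set
Box = Triple × Triple

eq3 : Triple → Triple → Bool
eq3 (a , b , c) (a' , b' , c') = (a ≡ᵇ a') ∧ (b ≡ᵇ b') ∧ (c ≡ᵇ c')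

isPermOf : Triple → Triple → Bool
isPermOf (t₁ , t₂ , t₃) d =
  any (eq3 d) ((t₁ , t₂ , t₃) ∷ (t₁ , t₃ , t₂) ∷ (t₂ , t₁ , t₃)
             ∷ (t₂ , t₃ , t₁) ∷ (t₃ , t₁ , t₂) ∷ (t₃ , t₂ , t₁) ∷ [])

triples : ℕ → ℕ → ℕ → List Triple
triples a b c =
  concatMap (λ x → concatMap (λ y → map (λ z → (x , y , z)) (upTo c)) (upTo b)) (upTo a)

inBox : Triple → Box → Bool
inBox (i , j , l) ((x , y , z) , (d₁ , d₂ , d₃)) =
  (x ≤ᵇ i) ∧ (i <ᵇ x + d₁) ∧ (y ≤ᵇ j) ∧ (j <ᵇ y + d₂) ∧ (z ≤ᵇ l) ∧ (l <ᵇ z + d₃)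

candidates : ℕ → ℕ → ℕ → Triple → List Box
candidates k m n t =
  filterᵇ ok (concatMap (λ c → map (λ d → (c , d)) (triples (suc k) (suc m) (suc n)))
                        (triples k m n))
  where
  ok : Box → Bool
  ok ((x , y , z) , d@(d₁ , d₂ , d₃)) =
    isPermOf t d ∧ (x + d₁ ≤ᵇ k) ∧ (y + d₂ ≤ᵇ m) ∧ (z + d₃ ≤ᵇ n)

-- all sub-lists (= subsets, since the list has no repetitions)
subsets : {A : Set} → List A → List (List A)
subsets []       = [] ∷ []
subsets (x ∷ xs) = map (x ∷_) (subsets xs) ++ subsets xs

countᵇ : {A : Set} → (A → Bool) → List A → ℕ
countᵇ p xs = length (filterᵇ p xs)

-- a set S of bricks is a tiling of the k×m×n box iff every unit cell of the box
-- lies in exactly one brick of S (bricks are already inside the box)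
isTiling : ℕ → ℕ → ℕ → List Box → Bool
isTiling k m n S = all (λ cell → countᵇ (inBox cell) S ≡ᵇ 1) (triples k m n)

tilingCount : ℕ → ℕ → ℕ → Triple → ℕ
tilingCount k m n t = countᵇ (isTiling k m n) (subsets (candidates k m n t))

aSeq : ℕ → ℕ
aSeq zero    = 1
aSeq (suc N) = if (suc N % 3) ≡ᵇ 0
               then tilingCount 3 4 (suc N / 3) (1 , 2 , 2)
               else 0

-- Polynomials over ℤ as finite lists of terms (c , e) meaning c·z^e,
-- formal power series over ℤ as coefficient functions ℕ → ℤ.

Poly : Set
Poly = List (ℤ × ℕ)

_*P_ : Poly → Poly → Poly
p *P q = concatMap (λ { (c , e) → map (λ { (c' , e') → (c ℤ.* c' , e + e') }) q }) p

coeffP : Poly → ℕ → ℤ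
coeffP p N = foldr (λ { (c , e) acc → (if e ≡ᵇ N then c else + 0) ℤ.+ acc }) (+ 0) p

mulPS : Poly → (ℕ → ℤ) → ℕ → ℤ
mulPS p A N = foldr (λ { (c , e) acc → (if e ≤ᵇ N then c ℤ.* A (N ∸ e) else + 0) ℤ.+ acc }) (+ 0) p

numerator : Poly
numerator = ((+ 1 , 0) ∷ (ℤ.- (+ 2) , 6) ∷ [])
         *P ((+ 1 , 0) ∷ (ℤ.- (+ 24) , 6) ∷ (+ 122 , 12) ∷ (ℤ.- (+ 120) , 18) ∷ [])

denominator : Poly
denominator = ((+ 1 , 0) ∷ (ℤ.- (+ 1) , 6) ∷ [])
           *P ((+ 1 , 0) ∷ (ℤ.- (+ 54) , 6) ∷ (+ 646 , 12) ∷ (ℤ.- (+ 2540) , 18)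
               ∷ (+ 2640 , 24) ∷ [])

-- The profile of a 3 × 4 × n box is the set of cells of its bottom layer that
-- bricks from below already occupy; 26 profiles occur. Placing the bricks based in the bottom
-- layer (they reach at most one layer up) so that this layer is filled leaves a box one layer
-- lower, again with one of the 26 profiles, so the vector of exact-cover counts satisfies
-- v(n + 1) = T v(n) for an explicit transition table T; the tilings are the counts for the empty
-- profile.
--
-- A box of height n contributes to z^(3n). The denominator annihilates the
-- series of every profile from degree 30 on: this is checked by evaluation in degrees 30, 31, 32
-- and propagates three degrees at a time, since shifting the series of a profile by one layer
-- turns it into a sum of series of profiles. The coefficients below degree 33 are compared
-- directly.

module Submission where

open import Defs
open import Data.Bool using (Bool; true; false; T; not; _∧_; _∨_; if_then_else_)
open import Data.Bool.Properties using (∧-assoc; ∧-comm; ∧-zeroʳ; T-∧)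
open import Data.Bool.ListAction using (all)
open import Data.Nat using (ℕ; zero; suc; z<s; s<s; _+_; _*_; _∸_; _%_; _/_; _≤_; _<_; z≤n; s≤s; _≤?_; _≟_; _≤ᵇ_; _<ᵇ_; _≡ᵇ_)
open import Data.Nat.DivMod using ([m+n]%n≡m%n; m/n≡1+[m∸n]/n)
open import Data.Nat.Properties using (+-identityʳ; +-comm; ≡ᵇ⇒≡; ≤ᵇ⇒≤; <ᵇ⇒<; <⇒≱; ≤-trans; allUpTo?)
open import Data.Nat.ListAction using (sum)
open import Data.Nat.ListAction.Properties using (sum-++)
open import Data.List using (List; []; _∷_; map; _++_; length; filterᵇ; concatMap; upTo; applyUpTo; findᵇ; allFin)
open import Data.List.Properties using (≡-dec; map-cong; ∷-injectiveˡ; ∷-injectiveʳ; length-++; filter-++; filter-none; filter-≐; map-++; map-∘; ++-assoc; ++-identityʳ; concatMap-cong; concatMap-map; concatMap-++; map-concatMap; map-applyUpTo; map-upTo)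
open import Data.List.Membership.Propositional using (_∈_)
open import Data.List.Membership.Propositional.Properties using (∈-++⁻; ∈-++⁺ˡ; ∈-map⁻)
open import Data.List.Relation.Unary.Any using (here; there)
import Data.List.Relation.Unary.All as All
open import Data.List.Relation.Unary.All.Properties using (all⁺; all⁻; applyUpTo⁺₁)
open import Data.List.Relation.Binary.Subset.Propositional using (_⊆_)
open import Data.List.Relation.Binary.Permutation.Propositional as ↭ using (_↭_; prep; swap; module PermutationReasoning)
open import Data.List.Relation.Binary.Permutation.Propositional.Properties using (↭-length; filter-↭; map⁺; ++⁺; ++⁺ˡ; shifts)
open import Data.Fin as Fin using (Fin; zero; suc; #_)
open import Data.Fin.Properties using (all?)
open import Data.Vec as Vec using (Vec; _∷_; [])
open import Data.Vec.Properties using (lookup∘tabulate)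
open import Data.Maybe using (Maybe; just)
import Data.Maybe.Properties as Maybe
open import Data.Integer as ℤ using (ℤ; +_)
import Data.Integer.Properties as ℤ
open import Data.Product using (_×_; _,_; ∃; proj₁; proj₂)
open import Data.Sum using (_⊎_; inj₁; inj₂; [_,_]′)
open import Function using (_∘_)
open import Function.Bundles using (Equivalence)
open import Relation.Nullary using (¬_; contradiction)
open import Relation.Unary using (_≐_)
open import Relation.Nullary.Decidable using (T?; toWitness)
open import Relation.Binary.PropositionalEquality using (_≡_; refl; sym; trans; cong; cong₂; subst; module ≡-Reasoning)

open import Algebra.Properties.CommutativeSemigroup Data.Nat.Properties.+-commutativeSemigroup using (interchange)
open import Algebra.Properties.CommutativeSemigroup ℤ.+-commutativeSemigroup using () renaming (interchange to ℤ-interchange)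

private variable
  A B : Set

countᵇ-++ : ∀ (p : A → Bool) xs ys → countᵇ p (xs ++ ys) ≡ countᵇ p xs + countᵇ p ys
countᵇ-++ p xs ys = trans (cong length (filter-++ (T? ∘ p) xs ys)) (length-++ (filterᵇ p xs))

countᵇ-map : ∀ (p : B → Bool) (f : A → B) xs → countᵇ p (map f xs) ≡ countᵇ (p ∘ f) xs
countᵇ-map p f []       = refl
countᵇ-map p f (x ∷ xs) with p (f x)
... | true  = cong suc (countᵇ-map p f xs)
... | false = countᵇ-map p f xs

countᵇ-cong : ∀ {p q : A → Bool} xs → (∀ {x} → x ∈ xs → p x ≡ q x) → countᵇ p xs ≡ countᵇ q xs
countᵇ-cong []                   _  = refl
countᵇ-cong {p = p} {q} (x ∷ xs) eq with p x | q x | eq (here refl)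
... | true  | true  | _ = cong suc (countᵇ-cong xs (eq ∘ there))
... | false | false | _ = countᵇ-cong xs (eq ∘ there)

countᵇ-none : ∀ {p : A → Bool} xs → (∀ {x} → x ∈ xs → ¬ T (p x)) → countᵇ p xs ≡ 0
countᵇ-none []                 _    = refl
countᵇ-none {p = p} (x ∷ xs) none with p x | none (here refl)
... | false | _   = countᵇ-none xs (none ∘ there)
... | true  | ¬px = contradiction _ ¬px

countᵇ-↭ : ∀ (p : A → Bool) {xs ys} → xs ↭ ys → countᵇ p xs ≡ countᵇ p ys
countᵇ-↭ p σ = ↭-length (filter-↭ (T? ∘ p) σ)

all-++ : ∀ (p : A → Bool) xs ys → all p (xs ++ ys) ≡ all p xs ∧ all p ys
all-++ p []       ys = refl
all-++ p (x ∷ xs) ys = trans (cong (p x ∧_) (all-++ p xs ys)) (sym (∧-assoc (p x) _ _))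

all-cong : ∀ {p q : A → Bool} xs → (∀ {x} → x ∈ xs → p x ≡ q x) → all p xs ≡ all q xs
all-cong []       _  = refl
all-cong (x ∷ xs) eq = cong₂ _∧_ (eq (here refl)) (all-cong xs (eq ∘ there))

all-↭ : ∀ (p : A → Bool) {xs ys} → xs ↭ ys → all p xs ≡ all p ys
all-↭ p ↭.refl        = refl
all-↭ p (prep x σ)    = cong (p x ∧_) (all-↭ p σ)
all-↭ p {x ∷ y ∷ xs} {y ∷ x ∷ ys} (swap x y σ) = begin
  p x ∧ (p y ∧ all p xs)  ≡⟨ cong (λ b → p x ∧ (p y ∧ b)) (all-↭ p σ) ⟩
  p x ∧ (p y ∧ all p ys)  ≡⟨ ∧-assoc (p x) (p y) _ ⟨
  (p x ∧ p y) ∧ all p ys  ≡⟨ cong (_∧ all p ys) (∧-comm (p x) (p y)) ⟩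
  (p y ∧ p x) ∧ all p ys  ≡⟨ ∧-assoc (p y) (p x) _ ⟩
  p y ∧ (p x ∧ all p ys)  ∎
  where open ≡-Reasoning
all-↭ p (↭.trans σ τ) = trans (all-↭ p σ) (all-↭ p τ)

countᵇ-subsets-∷ : ∀ (P : List A → Bool) x xs →
  countᵇ P (subsets (x ∷ xs)) ≡ countᵇ (P ∘ (x ∷_)) (subsets xs) + countᵇ P (subsets xs)
countᵇ-subsets-∷ P x xs =
  trans (countᵇ-++ P (map (x ∷_) (subsets xs)) (subsets xs))
        (cong (_+ countᵇ P (subsets xs)) (countᵇ-map P (x ∷_) (subsets xs)))

∈-subsets⇒⊆ : ∀ {S xs : List A} → S ∈ subsets xs → S ⊆ xs
∈-subsets⇒⊆ {xs = []}     (here refl) ()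
∈-subsets⇒⊆ {xs = x ∷ xs} S∈ with ∈-++⁻ (map (x ∷_) (subsets xs)) S∈
... | inj₂ S∈xs = there ∘ ∈-subsets⇒⊆ S∈xs
... | inj₁ S∈x∷ with ∈-map⁻ (x ∷_) S∈x∷
...   | S′ , S′∈ , refl = λ { (here refl) → here refl ; (there y∈) → there (∈-subsets⇒⊆ S′∈ y∈) }

subsets-map : ∀ (f : A → B) xs → subsets (map f xs) ≡ map (map f) (subsets xs)
subsets-map f []       = refl
subsets-map f (x ∷ xs) = begin
  map (f x ∷_) (subsets (map f xs)) ++ subsets (map f xs)
    ≡⟨ cong (λ ss → map (f x ∷_) ss ++ ss) (subsets-map f xs) ⟩
  map (f x ∷_) (map (map f) (subsets xs)) ++ map (map f) (subsets xs)
    ≡⟨ cong (_++ map (map f) (subsets xs)) (trans (sym (map-∘ (subsets xs))) (map-∘ (subsets xs))) ⟩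
  map (map f) (map (x ∷_) (subsets xs)) ++ map (map f) (subsets xs)
    ≡⟨ sym (map-++ (map f) (map (x ∷_) (subsets xs)) (subsets xs)) ⟩
  map (map f) (map (x ∷_) (subsets xs) ++ subsets xs) ∎
  where open ≡-Reasoning

countᵇ-subsets-↭ : ∀ (P : List A → Bool) → (∀ {S S′} → S ↭ S′ → P S ≡ P S′) →
  ∀ {xs ys} → xs ↭ ys → countᵇ P (subsets xs) ≡ countᵇ P (subsets ys)
countᵇ-subsets-↭ P inv ↭.refl = refl
countᵇ-subsets-↭ P inv {x ∷ xs} {x ∷ ys} (prep x σ) = begin
  countᵇ P (subsets (x ∷ xs))
    ≡⟨ countᵇ-subsets-∷ P x xs ⟩
  countᵇ (P ∘ (x ∷_)) (subsets xs) + countᵇ P (subsets xs)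
    ≡⟨ cong₂ _+_ (countᵇ-subsets-↭ (P ∘ (x ∷_)) (inv ∘ prep x) σ) (countᵇ-subsets-↭ P inv σ) ⟩
  countᵇ (P ∘ (x ∷_)) (subsets ys) + countᵇ P (subsets ys)
    ≡⟨ countᵇ-subsets-∷ P x ys ⟨
  countᵇ P (subsets (x ∷ ys)) ∎
  where open ≡-Reasoning
countᵇ-subsets-↭ P inv {x ∷ y ∷ xs} {y ∷ x ∷ ys} (swap x y σ) = begin
  countᵇ P (subsets (x ∷ y ∷ xs))
    ≡⟨ expand P x y xs ⟩
  (c (P ∘ (x ∷_) ∘ (y ∷_)) xs + c (P ∘ (x ∷_)) xs) + (c (P ∘ (y ∷_)) xs + c P xs)
    ≡⟨ cong₂ _+_ (cong₂ _+_ (countᵇ-cong (subsets xs) (λ {S} _ → inv (swap x y (↭.refl {xs = S})))) refl) refl ⟩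
  (c (P ∘ (y ∷_) ∘ (x ∷_)) xs + c (P ∘ (x ∷_)) xs) + (c (P ∘ (y ∷_)) xs + c P xs)
    ≡⟨ interchange (c (P ∘ (y ∷_) ∘ (x ∷_)) xs) (c (P ∘ (x ∷_)) xs) (c (P ∘ (y ∷_)) xs) (c P xs) ⟩
  (c (P ∘ (y ∷_) ∘ (x ∷_)) xs + c (P ∘ (y ∷_)) xs) + (c (P ∘ (x ∷_)) xs + c P xs)
    ≡⟨ cong₂ _+_ (cong₂ _+_ (same (P ∘ (y ∷_) ∘ (x ∷_)) (inv ∘ prep y ∘ prep x)) (same (P ∘ (y ∷_)) (inv ∘ prep y)))
                 (cong₂ _+_ (same (P ∘ (x ∷_)) (inv ∘ prep x)) (same P inv)) ⟩
  (c (P ∘ (y ∷_) ∘ (x ∷_)) ys + c (P ∘ (y ∷_)) ys) + (c (P ∘ (x ∷_)) ys + c P ys)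
    ≡⟨ expand P y x ys ⟨
  countᵇ P (subsets (y ∷ x ∷ ys)) ∎
  where
  open ≡-Reasoning
  c : (List A → Bool) → List A → ℕ
  c Q zs = countᵇ Q (subsets zs)
  same : ∀ Q → (∀ {S S′} → S ↭ S′ → Q S ≡ Q S′) → c Q xs ≡ c Q ys
  same Q invQ = countᵇ-subsets-↭ Q invQ σ
  expand : ∀ Q u v zs → c Q (u ∷ v ∷ zs) ≡ (c (Q ∘ (u ∷_) ∘ (v ∷_)) zs + c (Q ∘ (u ∷_)) zs) + (c (Q ∘ (v ∷_)) zs + c Q zs)
  expand Q u v zs = trans (countᵇ-subsets-∷ Q u (v ∷ zs))
    (cong₂ _+_ (countᵇ-subsets-∷ (Q ∘ (u ∷_)) v zs) (countᵇ-subsets-∷ Q v zs))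
countᵇ-subsets-↭ P inv (↭.trans σ τ) = trans (countᵇ-subsets-↭ P inv σ) (countᵇ-subsets-↭ P inv τ)

sum-map-++ : ∀ (g : A → ℕ) xs ys → sum (map g (xs ++ ys)) ≡ sum (map g xs) + sum (map g ys)
sum-map-++ g xs ys = trans (cong sum (map-++ g xs ys)) (sum-++ (map g xs) (map g ys))

sum-map-matched : ∀ (f : A → Maybe B) (g : A → ℕ) (h : B → ℕ) {xs ys} → map f xs ≡ map just ys →
  (∀ {x y} → x ∈ xs → f x ≡ just y → g x ≡ h y) → sum (map g xs) ≡ sum (map h ys)
sum-map-matched f g h {[]}     {[]}     _  _  = refl
sum-map-matched f g h {x ∷ xs} {y ∷ ys} eq gh =
  cong₂ _+_ (gh (here refl) (∷-injectiveˡ eq)) (sum-map-matched f g h (∷-injectiveʳ eq) (gh ∘ there))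

findᵇ-sound : ∀ (p : A → Bool) xs {x} → findᵇ p xs ≡ just x → T (p x)
findᵇ-sound p (y ∷ ys) found with p y in py
findᵇ-sound p (y ∷ ys) refl | true  = subst T (sym py) _
...                         | false = findᵇ-sound p ys found

filterᵇ-map : ∀ (p : B → Bool) (f : A → B) xs → filterᵇ p (map f xs) ≡ map f (filterᵇ (p ∘ f) xs)
filterᵇ-map p f []       = refl
filterᵇ-map p f (x ∷ xs) with p (f x)
... | true  = cong (f x ∷_) (filterᵇ-map p f xs)
... | false = filterᵇ-map p f xs

filterᵇ-∧ : ∀ (p q : A → Bool) xs → filterᵇ (λ x → p x ∧ q x) xs ≡ filterᵇ q (filterᵇ p xs)
filterᵇ-∧ p q []       = refl
filterᵇ-∧ p q (x ∷ xs) with p x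
... | false = filterᵇ-∧ p q xs
... | true with q x
...   | true  = cong (x ∷_) (filterᵇ-∧ p q xs)
...   | false = filterᵇ-∧ p q xs

filterᵇ-concatMap : ∀ (p : B → Bool) (f : A → List B) xs →
  filterᵇ p (concatMap f xs) ≡ concatMap (filterᵇ p ∘ f) xs
filterᵇ-concatMap p f []       = refl
filterᵇ-concatMap p f (x ∷ xs) =
  trans (filter-++ (T? ∘ p) (f x) (concatMap f xs)) (cong (filterᵇ p (f x) ++_) (filterᵇ-concatMap p f xs))

concatMap-cong-↭ : ∀ {f g : A → List B} xs → (∀ x → f x ↭ g x) → concatMap f xs ↭ concatMap g xs
concatMap-cong-↭ []       _  = ↭.refl
concatMap-cong-↭ (x ∷ xs) fg = ++⁺ (fg x) (concatMap-cong-↭ xs fg)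

concatMap⁺ : ∀ (f : A → List B) {xs ys} → xs ↭ ys → concatMap f xs ↭ concatMap f ys
concatMap⁺ f ↭.refl        = ↭.refl
concatMap⁺ f (prep x σ)    = ++⁺ˡ (f x) (concatMap⁺ f σ)
concatMap⁺ f (swap x y σ)  = ↭.trans (++⁺ˡ (f x) (++⁺ˡ (f y) (concatMap⁺ f σ))) (shifts (f x) (f y))
concatMap⁺ f (↭.trans σ τ) = ↭.trans (concatMap⁺ f σ) (concatMap⁺ f τ)

concatMap-++-↭ : ∀ (f g : A → List B) xs → concatMap (λ x → f x ++ g x) xs ↭ concatMap f xs ++ concatMap g xs
concatMap-++-↭ f g []       = ↭.refl
concatMap-++-↭ f g (x ∷ xs) = begin
  (f x ++ g x) ++ concatMap (λ x → f x ++ g x) xs  ≡⟨ ++-assoc (f x) (g x) _ ⟩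
  f x ++ g x ++ concatMap (λ x → f x ++ g x) xs    ↭⟨ ++⁺ˡ (f x) (++⁺ˡ (g x) (concatMap-++-↭ f g xs)) ⟩
  f x ++ g x ++ concatMap f xs ++ concatMap g xs   ↭⟨ ++⁺ˡ (f x) (shifts (g x) (concatMap f xs)) ⟩
  f x ++ concatMap f xs ++ g x ++ concatMap g xs   ≡⟨ ++-assoc (f x) (concatMap f xs) _ ⟨
  (f x ++ concatMap f xs) ++ g x ++ concatMap g xs ∎
  where open PermutationReasoning

Multiplicity : Set
Multiplicity = Triple → ℕ

coverage : List Box → Triple → ℕ
coverage S c = countᵇ (inBox c) S

exactOn : List Triple → Multiplicity → List Box → Bool
exactOn L r S = all (λ c → coverage S c ≡ᵇ r c) L

-- Opaque, so that conversion checking compares counts argument-wise instead of starting to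
-- enumerate the subsets of a symbolic list of bricks.
opaque
  exactCovers : List Triple → Multiplicity → List Box → ℕ
  exactCovers L r C = countᵇ (exactOn L r) (subsets C)

Avoids : List Box → List Triple → Set
Avoids B L = ∀ {b c} → b ∈ B → c ∈ L → ¬ T (inBox c b)

-- The truncation of ∸ never matters: residuals removes a brick only where it fits.
remove : Box → Multiplicity → Multiplicity
remove b r c = if inBox c b then r c ∸ 1 else r c

fits : Multiplicity → Box → Triple → Bool
fits r b c = not (inBox c b) ∨ (1 ≤ᵇ r c)

residuals : (done live : List Triple) → Multiplicity → List Box → List Multiplicity
residuals done live r []      = if all (λ c → 0 ≡ᵇ r c) done then r ∷ [] else []
residuals done live r (b ∷ B) =
  (if all (fits r b) live then residuals done live (remove b r) B else []) ++ residuals done live r B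

fits-outside : ∀ r b c → ¬ T (inBox c b) → T (fits r b c)
fits-outside r b c out with inBox c b
... | false = _
... | true  = contradiction _ out

exactAt⇒fits : ∀ r b c S → T (coverage (b ∷ S) c ≡ᵇ r c) → T (fits r b c)
exactAt⇒fits r b c S with inBox c b
... | false = λ _ → _
... | true with r c
...   | suc _ = λ _ → _

exactAt-∷ : ∀ r b c S → T (fits r b c) → (coverage (b ∷ S) c ≡ᵇ r c) ≡ (coverage S c ≡ᵇ remove b r c)
exactAt-∷ r b c S with inBox c b
... | false = λ _ → refl
... | true with r c
...   | suc _ = λ _ → refl

exactOn-∷ : ∀ {L r b} S → (∀ {c} → c ∈ L → T (fits r b c)) → exactOn L r (b ∷ S) ≡ exactOn L (remove b r) S
exactOn-∷ {L} {r} {b} S fit = all-cong L (λ {c} c∈ → exactAt-∷ r b c S (fit c∈))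

exactOn-∷-misfit : ∀ {L L′ r b} S → L′ ⊆ L → ¬ T (all (fits r b) L′) → ¬ T (exactOn L r (b ∷ S))
exactOn-∷-misfit {L} {L′} {r} {b} S L′⊆L misfit exact = misfit (all⁻ (fits r b) (All.tabulate fit))
  where
  fit : ∀ {c} → c ∈ L′ → T (fits r b c)
  fit c∈ = exactAt⇒fits r b _ S (All.lookup (all⁺ _ L exact) (L′⊆L c∈))

exactOn-finished : ∀ {L₀ r S} L → Avoids S L₀ → exactOn (L₀ ++ L) r S ≡ all (λ c → 0 ≡ᵇ r c) L₀ ∧ exactOn L r S
exactOn-finished {L₀} {r} {S} L S∩L₀ =
  trans (all-++ _ L₀ L) (cong (_∧ exactOn L r S) (all-cong L₀ (λ c∈ → cong (_≡ᵇ r _) (countᵇ-none S (λ b∈ → S∩L₀ b∈ c∈)))))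

remove-outside : ∀ b r c → ¬ T (inBox c b) → remove b r c ≡ r c
remove-outside b r c out with inBox c b
... | false = refl
... | true  = contradiction _ out

residuals-untouched : ∀ done live r B {r′ c} → r′ ∈ residuals done live r B →
  (∀ {b} → b ∈ B → ¬ T (inBox c b)) → r′ c ≡ r c
residuals-untouched done live r [] r′∈ out with all (λ c → 0 ≡ᵇ r c) done
residuals-untouched done live r [] (here refl) out | true = refl
residuals-untouched done live r (b ∷ B) r′∈ out with all (fits r b) live
... | false = residuals-untouched done live r B r′∈ (out ∘ there)
... | true with ∈-++⁻ (residuals done live (remove b r) B) r′∈
...   | inj₂ r′∈kept    = residuals-untouched done live r B r′∈kept (out ∘ there)
...   | inj₁ r′∈removed = trans (residuals-untouched done live (remove b r) B r′∈removed (out ∘ there))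
                                (remove-outside b r _ (out (here refl)))

up : Triple → Triple
up (x , y , z) = (x , y , suc z)

upBox : Box → Box
upBox (c , d) = (up c , d)

≤ᵇ-suc : ∀ m n → (suc m ≤ᵇ suc n) ≡ (m ≤ᵇ n)
≤ᵇ-suc zero    n = refl
≤ᵇ-suc (suc m) n = refl

inBox-up : ∀ c b → inBox (up c) (upBox b) ≡ inBox c b
inBox-up (i , j , l) ((x , y , z) , d) rewrite ≤ᵇ-suc z l = refl

inBox-height : ∀ i j l x y z d₁ d₂ d₃ → T (inBox (i , j , l) ((x , y , z) , (d₁ , d₂ , d₃))) → z ≤ l × l < z + d₃
inBox-height i j l x y z d₁ d₂ d₃ meets =
  let z≤l , l<top = ∧⁻ (z ≤ᵇ l) (∧ʳ (j <ᵇ y + d₂) (∧ʳ (y ≤ᵇ j) (∧ʳ (i <ᵇ x + d₁) (∧ʳ (x ≤ᵇ i) meets))))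
  in ≤ᵇ⇒≤ z l z≤l , <ᵇ⇒< l (z + d₃) l<top
  where
  ∧⁻ : ∀ a {b} → T (a ∧ b) → T a × T b
  ∧⁻ a = Equivalence.to (T-∧ {a})
  ∧ʳ : ∀ a {b} → T (a ∧ b) → T b
  ∧ʳ a = proj₂ ∘ ∧⁻ a

opaque
  unfolding exactCovers

  exactCovers-cong : ∀ {L r r′} C → (∀ {c} → c ∈ L → r c ≡ r′ c) → exactCovers L r C ≡ exactCovers L r′ C
  exactCovers-cong {L} C eq = countᵇ-cong (subsets C) (λ {S} _ → all-cong L (λ {c} c∈ → cong (coverage S c ≡ᵇ_) (eq c∈)))

  exactCovers-↭-cells : ∀ {L L′} r C → L ↭ L′ → exactCovers L r C ≡ exactCovers L′ r C
  exactCovers-↭-cells r C σ = countᵇ-cong (subsets C) (λ {S} _ → all-↭ (λ c → coverage S c ≡ᵇ r c) σ)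

  exactCovers-↭-bricks : ∀ L r {C C′} → C ↭ C′ → exactCovers L r C ≡ exactCovers L r C′
  exactCovers-↭-bricks L r = countᵇ-subsets-↭ (exactOn L r)
    (λ τ → all-cong L (λ {c} _ → cong (_≡ᵇ r c) (countᵇ-↭ (inBox c) τ)))

  exactCovers-up : ∀ L r C → exactCovers (map up L) r (map upBox C) ≡ exactCovers L (r ∘ up) C
  exactCovers-up L r C = begin
    countᵇ (exactOn (map up L) r) (subsets (map upBox C))
      ≡⟨ cong (countᵇ (exactOn (map up L) r)) (subsets-map upBox C) ⟩
    countᵇ (exactOn (map up L) r) (map (map upBox) (subsets C))
      ≡⟨ countᵇ-map (exactOn (map up L) r) (map upBox) (subsets C) ⟩
    countᵇ (exactOn (map up L) r ∘ map upBox) (subsets C)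
      ≡⟨ countᵇ-cong (subsets C) (λ {S} _ → exactOn-up S) ⟩
    countᵇ (exactOn L (r ∘ up)) (subsets C) ∎
    where
    open ≡-Reasoning
    exactOn-up : ∀ S → exactOn (map up L) r (map upBox S) ≡ exactOn L (r ∘ up) S
    exactOn-up S = trans (cong (Data.List.foldr _∧_ true) (sym (map-∘ L)))
      (all-cong L (λ {c} _ → cong (_≡ᵇ r (up c)) (trans (countᵇ-map (inBox (up c)) upBox S)
                                                      (countᵇ-cong S (λ {b} _ → inBox-up c b)))))

  exactCovers-peel : ∀ L₀ L₁ L₂ {C} → Avoids C L₀ → ∀ B r → Avoids B L₂ →
    exactCovers (L₀ ++ L₁ ++ L₂) r (B ++ C)
      ≡ sum (map (λ r′ → exactCovers (L₁ ++ L₂) r′ C) (residuals L₀ (L₀ ++ L₁) r B))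
  exactCovers-peel L₀ L₁ L₂ {C} C∩L₀ [] r _ =
    trans (countᵇ-cong (subsets C) (λ S∈ → exactOn-finished (L₁ ++ L₂) (C∩L₀ ∘ ∈-subsets⇒⊆ S∈))) (by-finished (all (λ c → 0 ≡ᵇ r c) L₀))
    where
    by-finished : ∀ done → countᵇ (λ S → done ∧ exactOn (L₁ ++ L₂) r S) (subsets C)
                         ≡ sum (map (λ r′ → exactCovers (L₁ ++ L₂) r′ C) (if done then r ∷ [] else []))
    by-finished true  = sym (+-identityʳ _)
    by-finished false = countᵇ-none {p = λ S → false ∧ exactOn (L₁ ++ L₂) r S} (subsets C) (λ _ ())
  exactCovers-peel L₀ L₁ L₂ {C} C∩L₀ (b ∷ B) r B∩L₂ = begin
    exactCovers L r ((b ∷ B) ++ C)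
      ≡⟨ countᵇ-subsets-∷ (exactOn L r) b (B ++ C) ⟩
    countᵇ (exactOn L r ∘ (b ∷_)) (subsets (B ++ C)) + exactCovers L r (B ++ C)
      ≡⟨ cong₂ _+_ (choosing-b (all (fits r b) (L₀ ++ L₁)) refl) (exactCovers-peel L₀ L₁ L₂ C∩L₀ B r (B∩L₂ ∘ there)) ⟩
    Σ (if all (fits r b) (L₀ ++ L₁) then residuals L₀ (L₀ ++ L₁) (remove b r) B else []) + Σ (residuals L₀ (L₀ ++ L₁) r B)
      ≡⟨ sum-map-++ (λ r′ → exactCovers (L₁ ++ L₂) r′ C) (if all (fits r b) (L₀ ++ L₁) then residuals L₀ (L₀ ++ L₁) (remove b r) B else []) (residuals L₀ (L₀ ++ L₁) r B) ⟨
    Σ (residuals L₀ (L₀ ++ L₁) r (b ∷ B)) ∎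
    where
    open ≡-Reasoning
    L : List Triple
    L = L₀ ++ L₁ ++ L₂
    Σ : List Multiplicity → ℕ
    Σ rs = sum (map (λ r′ → exactCovers (L₁ ++ L₂) r′ C) rs)
    reassoc : ∀ {c} → c ∈ (L₀ ++ L₁) ++ L₂ → c ∈ L
    reassoc = subst (_ ∈_) (++-assoc L₀ L₁ L₂)
    fit : T (all (fits r b) (L₀ ++ L₁)) → ∀ {c} → c ∈ L → T (fits r b c)
    fit fitsLive {c} c∈ with ∈-++⁻ (L₀ ++ L₁) (subst (_ ∈_) (sym (++-assoc L₀ L₁ L₂)) c∈)
    ... | inj₁ c∈live = All.lookup (all⁺ (fits r b) (L₀ ++ L₁) fitsLive) c∈live
    ... | inj₂ c∈L₂   = fits-outside r b c (B∩L₂ (here refl) c∈L₂)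
    choosing-b : ∀ fitsLive → all (fits r b) (L₀ ++ L₁) ≡ fitsLive →
      countᵇ (exactOn L r ∘ (b ∷_)) (subsets (B ++ C))
        ≡ Σ (if fitsLive then residuals L₀ (L₀ ++ L₁) (remove b r) B else [])
    choosing-b true  eq = trans (countᵇ-cong (subsets (B ++ C)) (λ {S} _ → exactOn-∷ {L} {r} {b} S (fit (subst T (sym eq) _))))
                            (exactCovers-peel L₀ L₁ L₂ C∩L₀ B (remove b r) (B∩L₂ ∘ there))
    choosing-b false eq = countᵇ-none (subsets (B ++ C)) (λ {S} _ → exactOn-∷-misfit {L} {L₀ ++ L₁} {r} {b} S (reassoc ∘ ∈-++⁺ˡ) (subst (¬_ ∘ T) (sym eq) (λ ())))

triples-suc : ∀ a b c → triples a b (suc c) ↭ triples a b 1 ++ map up (triples a b c)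
triples-suc a b c = begin
  concatMap (λ x → concatMap (λ y → column x y (suc c)) (upTo b)) (upTo a)
    ≡⟨ concatMap-cong (λ x → concatMap-cong (λ y → column-suc x y) (upTo b)) (upTo a) ⟩
  concatMap (λ x → concatMap (λ y → column x y 1 ++ map up (column x y c)) (upTo b)) (upTo a)
    ↭⟨ concatMap-cong-↭ (upTo a) (λ x → concatMap-++-↭ (λ y → column x y 1) (λ y → map up (column x y c)) (upTo b)) ⟩
  concatMap (λ x → concatMap (λ y → column x y 1) (upTo b) ++ concatMap (λ y → map up (column x y c)) (upTo b)) (upTo a)
    ↭⟨ concatMap-++-↭ _ _ (upTo a) ⟩
  triples a b 1 ++ concatMap (λ x → concatMap (λ y → map up (column x y c)) (upTo b)) (upTo a)
    ≡⟨ cong (triples a b 1 ++_) (trans (concatMap-cong (λ x → sym (map-concatMap up (λ y → column x y c) (upTo b))) (upTo a))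
                                       (sym (map-concatMap up _ (upTo a)))) ⟩
  triples a b 1 ++ map up (triples a b c) ∎
  where
  open PermutationReasoning
  column : ℕ → ℕ → ℕ → List Triple
  column x y h = map (λ z → (x , y , z)) (upTo h)
  column-suc : ∀ x y → column x y (suc c) ≡ column x y 1 ++ map up (column x y c)
  column-suc x y = cong ((x , y , 0) ∷_)
    (trans (map-applyUpTo suc (λ z → (x , y , z)) c) (sym (trans (sym (map-∘ (upTo c))) (map-upTo (up ∘ λ z → (x , y , z)) c))))

brick : Triple
brick = (1 , 2 , 2)

orientations : List Triple
orientations = filterᵇ (isPermOf brick) (triples 4 5 3)

inside : ℕ → Box → Bool
inside n ((x , y , z) , (d₁ , d₂ , d₃)) = (x + d₁ ≤ᵇ 3) ∧ (y + d₂ ≤ᵇ 4) ∧ (z + d₃ ≤ᵇ n)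

placedAt : Triple → List Box
placedAt c = map (c ,_) orientations

placements : ℕ → List Box
placements n = filterᵇ (inside n) (concatMap placedAt (triples 3 4 n))

isPermOf-tall : ∀ x y k → ¬ T (isPermOf brick (x , y , 3 + k))
isPermOf-tall x y k rewrite ∧-zeroʳ (y ≡ᵇ 2) | ∧-zeroʳ (y ≡ᵇ 1) | ∧-zeroʳ (x ≡ᵇ 1) | ∧-zeroʳ (x ≡ᵇ 2) = λ ()

filterᵇ-triples-tall : ∀ (p : Triple → Bool) a b m → (∀ x y k → ¬ T (p (x , y , 3 + k))) →
  filterᵇ p (triples a b (3 + m)) ≡ filterᵇ p (triples a b 3)
filterᵇ-triples-tall p a b m low = begin
  filterᵇ p (triples a b (3 + m))
    ≡⟨ filterᵇ-concatMap p _ (upTo a) ⟩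
  concatMap (λ x → filterᵇ p (concatMap (λ y → column x y (3 + m)) (upTo b))) (upTo a)
    ≡⟨ concatMap-cong (λ x → trans (filterᵇ-concatMap p _ (upTo b))
                               (trans (concatMap-cong (λ y → column-tall x y) (upTo b))
                                      (sym (filterᵇ-concatMap p _ (upTo b))))) (upTo a) ⟩
  concatMap (λ x → filterᵇ p (concatMap (λ y → column x y 3) (upTo b))) (upTo a)
    ≡⟨ filterᵇ-concatMap p _ (upTo a) ⟨
  filterᵇ p (triples a b 3) ∎
  where
  open ≡-Reasoning
  column : ℕ → ℕ → ℕ → List Triple
  column x y h = map (λ z → (x , y , z)) (upTo h)
  column-tall : ∀ x y → filterᵇ p (column x y (3 + m)) ≡ filterᵇ p (column x y 3)
  column-tall x y = begin
    filterᵇ p (column x y 3 ++ map (λ z → (x , y , z)) (applyUpTo (λ k → 3 + k) m))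
      ≡⟨ filter-++ (T? ∘ p) (column x y 3) _ ⟩
    filterᵇ p (column x y 3) ++ filterᵇ p (map (λ z → (x , y , z)) (applyUpTo (λ k → 3 + k) m))
      ≡⟨ cong (filterᵇ p (column x y 3) ++_) (trans (cong (filterᵇ p) (map-applyUpTo (λ k → 3 + k) _ m))
                                                   (filter-none (T? ∘ p) (applyUpTo⁺₁ _ m (λ {k} _ → low x y k)))) ⟩
    filterᵇ p (column x y 3) ++ []
      ≡⟨ ++-identityʳ _ ⟩
    filterᵇ p (column x y 3) ∎

candidates≡placements : ∀ n → candidates 3 4 (suc n) brick ≡ placements (suc n)
candidates≡placements zero    = refl
candidates≡placements (suc m) = begin
  filterᵇ (λ b → isPermOf brick (proj₂ b) ∧ inside (2 + m) b) (concatMap (λ c → map (c ,_) (triples 4 5 (3 + m))) corners)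
    ≡⟨ filterᵇ-∧ (isPermOf brick ∘ proj₂) (inside (2 + m)) (concatMap (λ c → map (c ,_) (triples 4 5 (3 + m))) corners) ⟩
  filterᵇ (inside (2 + m)) (filterᵇ (isPermOf brick ∘ proj₂) (concatMap (λ c → map (c ,_) (triples 4 5 (3 + m))) corners))
    ≡⟨ cong (filterᵇ (inside (2 + m))) (trans (filterᵇ-concatMap (isPermOf brick ∘ proj₂) (λ c → map (c ,_) (triples 4 5 (3 + m))) corners) (concatMap-cong upright corners)) ⟩
  filterᵇ (inside (2 + m)) (concatMap placedAt corners) ∎
  where
  open ≡-Reasoning
  corners : List Triple
  corners = triples 3 4 (2 + m)
  upright : ∀ c → filterᵇ (isPermOf brick ∘ proj₂) (map (c ,_) (triples 4 5 (3 + m))) ≡ placedAt c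
  upright c = trans (filterᵇ-map (isPermOf brick ∘ proj₂) (c ,_) (triples 4 5 (3 + m)))
                    (cong (map (c ,_)) (filterᵇ-triples-tall (isPermOf brick) 4 5 m isPermOf-tall))

layer : List Triple
layer = triples 3 4 1

floorBricks : List Box
floorBricks = filterᵇ (inside 2) (concatMap placedAt layer)

inside-up : ∀ n b → inside (suc n) (upBox b) ≡ inside n b
inside-up n ((x , y , z) , (d₁ , d₂ , d₃)) rewrite ≤ᵇ-suc (z + d₃) n = refl

placements-suc : ∀ n → placements (suc (suc n)) ↭ floorBricks ++ map upBox (placements (suc n))
placements-suc n = begin
  filterᵇ (inside (suc (suc n))) (concatMap placedAt (triples 3 4 (suc (suc n))))
    ↭⟨ filter-↭ (T? ∘ inside (suc (suc n))) (concatMap⁺ placedAt (triples-suc 3 4 (suc n))) ⟩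
  filterᵇ (inside (suc (suc n))) (concatMap placedAt (layer ++ map up cells))
    ≡⟨ cong (filterᵇ (inside (suc (suc n)))) (concatMap-++ placedAt layer (map up cells)) ⟩
  filterᵇ (inside (suc (suc n))) (concatMap placedAt layer ++ concatMap placedAt (map up cells))
    ≡⟨ filter-++ (T? ∘ inside (suc (suc n))) (concatMap placedAt layer) (concatMap placedAt (map up cells)) ⟩
  -- the floor bricks have height at most 2, so the filter for height n + 2 keeps all of them
  floorBricks ++ filterᵇ (inside (suc (suc n))) (concatMap placedAt (map up cells))
    ≡⟨ cong (λ bs → floorBricks ++ filterᵇ (inside (suc (suc n))) bs) lift ⟩
  floorBricks ++ filterᵇ (inside (suc (suc n))) (map upBox (concatMap placedAt cells))
    ≡⟨ cong (floorBricks ++_) (filterᵇ-map (inside (suc (suc n))) upBox (concatMap placedAt cells)) ⟩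
  floorBricks ++ map upBox (filterᵇ (inside (suc (suc n)) ∘ upBox) (concatMap placedAt cells))
    ≡⟨ cong (λ bs → floorBricks ++ map upBox bs) (filter-≐ (T? ∘ inside (suc (suc n)) ∘ upBox) (T? ∘ inside (suc n)) same (concatMap placedAt cells)) ⟩
  floorBricks ++ map upBox (placements (suc n)) ∎
  where
  open PermutationReasoning
  cells : List Triple
  cells = triples 3 4 (suc n)
  lift : concatMap placedAt (map up cells) ≡ map upBox (concatMap placedAt cells)
  lift = trans (concatMap-map placedAt up cells)
               (trans (concatMap-cong (λ c → map-∘ {g = upBox} {f = c ,_} orientations) cells) (sym (map-concatMap upBox placedAt cells)))
  same : (T ∘ inside (suc (suc n)) ∘ upBox) ≐ (T ∘ inside (suc n))
  same = (λ {b} → subst T (inside-up (suc n) b)) , (λ {b} → subst T (sym (inside-up (suc n) b)))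

-- Row i gives the requirement of profile i at cell (x , y , 0) in position 4x + y:
-- 0 if the cell is already occupied from below, 1 if it still has to be covered.
profiles : Vec (List ℕ) 26
profiles =
    (1 ∷ 1 ∷ 1 ∷ 1 ∷ 1 ∷ 1 ∷ 1 ∷ 1 ∷ 1 ∷ 1 ∷ 1 ∷ 1 ∷ [])
  ∷ (1 ∷ 1 ∷ 1 ∷ 1 ∷ 1 ∷ 1 ∷ 1 ∷ 1 ∷ 0 ∷ 0 ∷ 0 ∷ 0 ∷ [])
  ∷ (1 ∷ 1 ∷ 0 ∷ 0 ∷ 1 ∷ 1 ∷ 0 ∷ 0 ∷ 0 ∷ 0 ∷ 0 ∷ 0 ∷ [])
  ∷ (1 ∷ 1 ∷ 0 ∷ 0 ∷ 1 ∷ 1 ∷ 1 ∷ 1 ∷ 0 ∷ 0 ∷ 1 ∷ 1 ∷ [])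
  ∷ (0 ∷ 1 ∷ 1 ∷ 0 ∷ 0 ∷ 1 ∷ 1 ∷ 0 ∷ 0 ∷ 0 ∷ 0 ∷ 0 ∷ [])
  ∷ (0 ∷ 0 ∷ 1 ∷ 1 ∷ 0 ∷ 0 ∷ 1 ∷ 1 ∷ 0 ∷ 0 ∷ 0 ∷ 0 ∷ [])
  ∷ (0 ∷ 0 ∷ 0 ∷ 0 ∷ 0 ∷ 0 ∷ 0 ∷ 0 ∷ 0 ∷ 0 ∷ 0 ∷ 0 ∷ [])
  ∷ (0 ∷ 0 ∷ 0 ∷ 0 ∷ 0 ∷ 0 ∷ 1 ∷ 1 ∷ 0 ∷ 0 ∷ 1 ∷ 1 ∷ [])
  ∷ (0 ∷ 0 ∷ 1 ∷ 1 ∷ 1 ∷ 1 ∷ 1 ∷ 1 ∷ 1 ∷ 1 ∷ 0 ∷ 0 ∷ [])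
  ∷ (0 ∷ 0 ∷ 0 ∷ 0 ∷ 1 ∷ 1 ∷ 0 ∷ 0 ∷ 1 ∷ 1 ∷ 0 ∷ 0 ∷ [])
  ∷ (0 ∷ 0 ∷ 0 ∷ 0 ∷ 1 ∷ 1 ∷ 1 ∷ 1 ∷ 1 ∷ 1 ∷ 1 ∷ 1 ∷ [])
  ∷ (0 ∷ 0 ∷ 0 ∷ 0 ∷ 0 ∷ 1 ∷ 1 ∷ 0 ∷ 0 ∷ 1 ∷ 1 ∷ 0 ∷ [])
  ∷ (1 ∷ 1 ∷ 0 ∷ 0 ∷ 1 ∷ 1 ∷ 0 ∷ 0 ∷ 1 ∷ 1 ∷ 1 ∷ 1 ∷ [])
  ∷ (0 ∷ 1 ∷ 1 ∷ 0 ∷ 0 ∷ 1 ∷ 1 ∷ 0 ∷ 1 ∷ 1 ∷ 1 ∷ 1 ∷ [])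
  ∷ (0 ∷ 0 ∷ 1 ∷ 1 ∷ 0 ∷ 0 ∷ 1 ∷ 1 ∷ 1 ∷ 1 ∷ 1 ∷ 1 ∷ [])
  ∷ (0 ∷ 0 ∷ 0 ∷ 0 ∷ 0 ∷ 0 ∷ 0 ∷ 0 ∷ 1 ∷ 1 ∷ 1 ∷ 1 ∷ [])
  ∷ (1 ∷ 1 ∷ 1 ∷ 1 ∷ 1 ∷ 1 ∷ 0 ∷ 0 ∷ 1 ∷ 1 ∷ 0 ∷ 0 ∷ [])
  ∷ (0 ∷ 0 ∷ 1 ∷ 1 ∷ 0 ∷ 0 ∷ 0 ∷ 0 ∷ 1 ∷ 1 ∷ 0 ∷ 0 ∷ [])
  ∷ (1 ∷ 0 ∷ 0 ∷ 1 ∷ 1 ∷ 0 ∷ 0 ∷ 1 ∷ 1 ∷ 1 ∷ 1 ∷ 1 ∷ [])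
  ∷ (1 ∷ 1 ∷ 1 ∷ 1 ∷ 0 ∷ 0 ∷ 1 ∷ 1 ∷ 0 ∷ 0 ∷ 1 ∷ 1 ∷ [])
  ∷ (1 ∷ 1 ∷ 0 ∷ 0 ∷ 0 ∷ 0 ∷ 0 ∷ 0 ∷ 0 ∷ 0 ∷ 1 ∷ 1 ∷ [])
  ∷ (1 ∷ 1 ∷ 1 ∷ 1 ∷ 0 ∷ 1 ∷ 1 ∷ 0 ∷ 0 ∷ 1 ∷ 1 ∷ 0 ∷ [])
  ∷ (1 ∷ 1 ∷ 1 ∷ 1 ∷ 0 ∷ 0 ∷ 0 ∷ 0 ∷ 0 ∷ 0 ∷ 0 ∷ 0 ∷ [])
  ∷ (1 ∷ 1 ∷ 1 ∷ 1 ∷ 1 ∷ 0 ∷ 0 ∷ 1 ∷ 1 ∷ 0 ∷ 0 ∷ 1 ∷ [])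
  ∷ (1 ∷ 0 ∷ 0 ∷ 1 ∷ 1 ∷ 0 ∷ 0 ∷ 1 ∷ 0 ∷ 0 ∷ 0 ∷ 0 ∷ [])
  ∷ (0 ∷ 0 ∷ 0 ∷ 0 ∷ 1 ∷ 0 ∷ 0 ∷ 1 ∷ 1 ∷ 0 ∷ 0 ∷ 1 ∷ [])
  ∷ []

entry : List ℕ → ℕ → ℕ
entry []       _       = 1
entry (v ∷ _)  zero    = v
entry (_ ∷ vs) (suc k) = entry vs k

-- The first clause makes profileCount n 0 the tiling count by definition.
requirement : Fin 26 → Multiplicity
requirement zero _              = 1
requirement i    (x , y , zero)  = entry (Vec.lookup profiles i) (x * 4 + y)
requirement i    (x , y , suc _) = 1

requirement-up : ∀ i c → requirement i (up c) ≡ 1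
requirement-up zero    c = refl
requirement-up (suc i) c = refl

profileCount : ℕ → Fin 26 → ℕ
profileCount n i = exactCovers (triples 3 4 n) (requirement i) (candidates 3 4 n brick)

nextResiduals : Fin 26 → List Multiplicity
nextResiduals i = residuals layer (layer ++ map up layer) (requirement i) floorBricks

matches : Multiplicity → Fin 26 → Bool
matches r j = all (λ c → r (up c) ≡ᵇ requirement j c) layer

classify : Multiplicity → Maybe (Fin 26)
classify r = findᵇ (matches r) (allFin 26)

-- Row i lists, with multiplicity, the profiles left by the ways of filling the bottom layer of
-- profile i; transitions-classify checks it against nextResiduals.
transitions : Vec (List (Fin 26)) 26
transitions =
    (# 6 ∷ # 6 ∷ # 7 ∷ # 6 ∷ # 6 ∷ # 6 ∷ # 7 ∷ # 11 ∷ # 9 ∷ # 9 ∷ # 10 ∷ # 6 ∷ # 6 ∷ # 9 ∷ # 5 ∷ # 5 ∷ # 8 ∷ # 6 ∷ # 6 ∷ # 6 ∷ # 7 ∷ # 6 ∷ # 5 ∷ # 4 ∷ # 2 ∷ # 2 ∷ # 3 ∷ # 2 ∷ # 1 ∷ [])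
  ∷ (# 15 ∷ # 15 ∷ # 14 ∷ # 15 ∷ # 15 ∷ # 15 ∷ # 14 ∷ # 13 ∷ # 12 ∷ # 12 ∷ # 0 ∷ [])
  ∷ (# 14 ∷ # 14 ∷ # 0 ∷ [])
  ∷ (# 17 ∷ # 17 ∷ # 14 ∷ # 17 ∷ # 17 ∷ # 14 ∷ # 16 ∷ # 16 ∷ # 0 ∷ [])
  ∷ (# 18 ∷ # 18 ∷ # 0 ∷ [])
  ∷ (# 12 ∷ # 12 ∷ # 0 ∷ [])
  ∷ (# 0 ∷ [])
  ∷ (# 16 ∷ # 16 ∷ # 0 ∷ [])
  ∷ (# 20 ∷ # 20 ∷ # 12 ∷ # 20 ∷ # 20 ∷ # 12 ∷ # 19 ∷ # 19 ∷ # 0 ∷ [])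
  ∷ (# 19 ∷ # 19 ∷ # 0 ∷ [])
  ∷ (# 22 ∷ # 22 ∷ # 19 ∷ # 22 ∷ # 22 ∷ # 22 ∷ # 19 ∷ # 21 ∷ # 16 ∷ # 16 ∷ # 0 ∷ [])
  ∷ (# 23 ∷ # 23 ∷ # 0 ∷ [])
  ∷ (# 5 ∷ # 5 ∷ # 8 ∷ # 5 ∷ # 1 ∷ [])
  ∷ (# 24 ∷ # 24 ∷ # 1 ∷ [])
  ∷ (# 2 ∷ # 2 ∷ # 3 ∷ # 2 ∷ # 1 ∷ [])
  ∷ (# 1 ∷ [])
  ∷ (# 7 ∷ # 7 ∷ # 10 ∷ # 7 ∷ # 3 ∷ [])
  ∷ (# 3 ∷ [])
  ∷ (# 4 ∷ [])
  ∷ (# 9 ∷ # 9 ∷ # 10 ∷ # 9 ∷ # 8 ∷ [])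
  ∷ (# 8 ∷ [])
  ∷ (# 25 ∷ # 25 ∷ # 10 ∷ [])
  ∷ (# 10 ∷ [])
  ∷ (# 11 ∷ [])
  ∷ (# 13 ∷ [])
  ∷ (# 21 ∷ [])
  ∷ []

transitions-classify : ∀ i → map classify (nextResiduals i) ≡ map just (Vec.lookup transitions i)
transitions-classify = toWitness {a? = all? λ i → ≡-dec (Maybe.≡-dec Fin._≟_) (map classify (nextResiduals i)) (map just (Vec.lookup transitions i))} _

floorBricks-low : All.All (λ ((_ , _ , z) , (_ , _ , d₃)) → z + d₃ ≤ 2) floorBricks
floorBricks-low = toWitness {a? = All.all? (λ ((_ , _ , z) , (_ , _ , d₃)) → z + d₃ ≤? 2) floorBricks} _

floorBricks-avoid-above : ∀ L → Avoids floorBricks (map up (map up L))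
floorBricks-avoid-above L {(x , y , z) , (d₁ , d₂ , d₃)} b∈ c∈ meets with ∈-map⁻ up c∈
... | _ , c′∈ , refl with ∈-map⁻ up c′∈
...   | (i , j , l) , _ , refl =
  let _ , above = inBox-height i j (2 + l) x y z d₁ d₂ d₃ meets
  in <⇒≱ above (≤-trans (All.lookup floorBricks-low b∈) (s≤s (s≤s z≤n)))

layer-flat : All.All (λ (_ , _ , l) → l ≡ 0) layer
layer-flat = toWitness {a? = All.all? (λ (_ , _ , l) → l ≟ 0) layer} _

upBoxes-avoid-layer : ∀ C → Avoids (map upBox C) layer
upBoxes-avoid-layer C {b} {i , j , l} b∈ c∈ meets with ∈-map⁻ upBox b∈ | All.lookup layer-flat c∈
... | ((x , y , z) , (d₁ , d₂ , d₃)) , _ , refl | refl with inBox-height i j 0 x y (suc z) d₁ d₂ d₃ meets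
...   | () , _

layer-split : ∀ n → triples 3 4 (suc (suc n)) ↭ layer ++ map up layer ++ map up (map up (triples 3 4 n))
layer-split n = ↭.trans (triples-suc 3 4 (suc n))
  (++⁺ˡ layer (↭.trans (map⁺ up (triples-suc 3 4 n)) (↭.↭-reflexive (map-++ up layer (map up (triples 3 4 n))))))

classify-sound : ∀ r {j} → classify r ≡ just j → ∀ {c} → c ∈ layer → r (up c) ≡ requirement j c
classify-sound r {j} classified {c} c∈ =
  ≡ᵇ⇒≡ (r (up c)) (requirement j c)
    (All.lookup (all⁺ (λ c → r (up c) ≡ᵇ requirement j c) layer (findᵇ-sound (matches r) (allFin 26) classified)) c∈)

residual-above-floor : ∀ i {r′} → r′ ∈ nextResiduals i → ∀ c → r′ (up (up c)) ≡ 1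
residual-above-floor i r′∈ c =
  trans (residuals-untouched layer (layer ++ map up layer) (requirement i) floorBricks r′∈
                             (λ b∈ → floorBricks-avoid-above (c ∷ []) b∈ (here refl)))
        (requirement-up i (up c))

agree-above : ∀ {r′ : Multiplicity} j L → (∀ c → r′ (up (up c)) ≡ 1) → ∀ {c} → c ∈ map up L → r′ (up c) ≡ requirement j c
agree-above j L high c∈ with ∈-map⁻ up c∈
... | c′ , _ , refl = trans (high c′) (sym (requirement-up j c′))

residual-count : ∀ n i {r′ j} → r′ ∈ nextResiduals i → classify r′ ≡ just j →
  exactCovers (map up layer ++ map up (map up (triples 3 4 n))) r′ (map upBox (placements (suc n)))
    ≡ profileCount (suc n) j
residual-count n i {r′} {j} r′∈ classified = begin
  exactCovers (map up layer ++ map up (map up cells)) r′ (map upBox (placements (suc n)))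
    ≡⟨ cong (λ L → exactCovers L r′ (map upBox (placements (suc n)))) (map-++ up layer (map up cells)) ⟨
  exactCovers (map up (layer ++ map up cells)) r′ (map upBox (placements (suc n)))
    ≡⟨ exactCovers-up (layer ++ map up cells) r′ (placements (suc n)) ⟩
  exactCovers (layer ++ map up cells) (r′ ∘ up) (placements (suc n))
    ≡⟨ exactCovers-cong (placements (suc n)) agree ⟩
  exactCovers (layer ++ map up cells) (requirement j) (placements (suc n))
    ≡⟨ exactCovers-↭-cells (requirement j) (placements (suc n)) (↭.↭-sym (triples-suc 3 4 n)) ⟩
  exactCovers (triples 3 4 (suc n)) (requirement j) (placements (suc n))
    ≡⟨ cong (exactCovers (triples 3 4 (suc n)) (requirement j)) (candidates≡placements n) ⟨
  profileCount (suc n) j ∎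
  where
  open ≡-Reasoning
  cells : List Triple
  cells = triples 3 4 n
  agree : ∀ {c} → c ∈ layer ++ map up cells → r′ (up c) ≡ requirement j c
  agree c∈ = [ classify-sound r′ classified , agree-above {r′} j cells (residual-above-floor i r′∈) ]′ (∈-++⁻ layer c∈)

profileCount-transfer : ∀ n i → profileCount (suc (suc n)) i ≡ sum (map (profileCount (suc n)) (Vec.lookup transitions i))
profileCount-transfer n i = begin
  exactCovers (triples 3 4 (suc (suc n))) (requirement i) (candidates 3 4 (suc (suc n)) brick)
    ≡⟨ cong (exactCovers (triples 3 4 (suc (suc n))) (requirement i)) (candidates≡placements (suc n)) ⟩
  exactCovers (triples 3 4 (suc (suc n))) (requirement i) (placements (suc (suc n)))
    ≡⟨ exactCovers-↭-cells (requirement i) (placements (suc (suc n))) (layer-split n) ⟩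
  exactCovers (layer ++ upper) (requirement i) (placements (suc (suc n)))
    ≡⟨ exactCovers-↭-bricks (layer ++ upper) (requirement i) (placements-suc n) ⟩
  exactCovers (layer ++ upper) (requirement i) (floorBricks ++ map upBox (placements (suc n)))
    ≡⟨ exactCovers-peel layer (map up layer) (map up (map up cells)) (upBoxes-avoid-layer (placements (suc n)))
                        floorBricks (requirement i) (floorBricks-avoid-above cells) ⟩
  sum (map (λ r′ → exactCovers upper r′ (map upBox (placements (suc n)))) (nextResiduals i))
    ≡⟨ sum-map-matched classify _ (profileCount (suc n)) {nextResiduals i} {Vec.lookup transitions i} (transitions-classify i) (residual-count n i) ⟩
  sum (map (profileCount (suc n)) (Vec.lookup transitions i)) ∎
  where
  open ≡-Reasoning
  cells : List Triple
  cells = triples 3 4 n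
  upper : List Triple
  upper = map up layer ++ map up (map up cells)

heightOneCounts : Vec ℕ 26
heightOneCounts = 0 ∷ 1 ∷ 1 ∷ 1 ∷ 1 ∷ 1 ∷ 1 ∷ 1 ∷ 1 ∷ 1 ∷ 1 ∷ 1 ∷ 0 ∷ 0 ∷ 0 ∷ 0 ∷ 0 ∷ 0 ∷ 0 ∷ 0 ∷ 0 ∷ 0 ∷ 0 ∷ 0 ∷ 0 ∷ 0 ∷ []

opaque
  unfolding exactCovers

  tilingCount≡profileCount : ∀ n → tilingCount 3 4 n brick ≡ profileCount n zero
  tilingCount≡profileCount n = refl

  profileCount-heightOne : ∀ i → profileCount 1 i ≡ Vec.lookup heightOneCounts i
  profileCount-heightOne = toWitness {a? = all? λ i → profileCount 1 i ≟ Vec.lookup heightOneCounts i} _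

transfer : Vec ℕ 26 → Vec ℕ 26
transfer v = Vec.tabulate λ i → sum (map (Vec.lookup v) (Vec.lookup transitions i))

-- Opaque for the same reason as exactCovers: unfolding counts on a symbolic argument blows up.
opaque
  counts : ℕ → Vec ℕ 26
  counts zero    = heightOneCounts
  counts (suc q) = transfer (counts q)

  counts-zero : counts zero ≡ heightOneCounts
  counts-zero = refl

  counts-suc : ∀ q → counts (suc q) ≡ transfer (counts q)
  counts-suc q = refl

profileCount≡counts : ∀ q i → profileCount (suc q) i ≡ Vec.lookup (counts q) i
profileCount≡counts zero    i = trans (profileCount-heightOne i) (cong (λ v → Vec.lookup v i) (sym counts-zero))
profileCount≡counts (suc q) i = begin
  profileCount (suc (suc q)) i
    ≡⟨ profileCount-transfer q i ⟩
  sum (map (profileCount (suc q)) (Vec.lookup transitions i))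
    ≡⟨ cong sum (map-cong (profileCount≡counts q) (Vec.lookup transitions i)) ⟩
  sum (map (Vec.lookup (counts q)) (Vec.lookup transitions i))
    ≡⟨ lookup∘tabulate (λ i → sum (map (Vec.lookup (counts q)) (Vec.lookup transitions i))) i ⟨
  Vec.lookup (transfer (counts q)) i
    ≡⟨ cong (λ v → Vec.lookup v i) (counts-suc q) ⟨
  Vec.lookup (counts (suc q)) i ∎
  where open ≡-Reasoning

tilings : ℕ → ℕ
tilings zero    = 1
tilings (suc q) = Vec.lookup (counts q) zero

tilingCount≡tilings : ∀ q → tilingCount 3 4 q brick ≡ tilings q
tilingCount≡tilings zero    = refl
tilingCount≡tilings (suc q) = trans (tilingCount≡profileCount (suc q)) (profileCount≡counts q zero)

-- The generating function of spread₃ 0 f is that of f evaluated at x³.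
spread₃ : A → (ℕ → A) → ℕ → A
spread₃ z f zero                = f zero
spread₃ z f (suc zero)          = z
spread₃ z f (suc (suc zero))    = z
spread₃ z f (suc (suc (suc n))) = spread₃ z (f ∘ suc) n

spread₃-map : ∀ (g : A → B) z f n → g (spread₃ z f n) ≡ spread₃ (g z) (g ∘ f) n
spread₃-map g z f zero                = refl
spread₃-map g z f (suc zero)          = refl
spread₃-map g z f (suc (suc zero))    = refl
spread₃-map g z f (suc (suc (suc n))) = spread₃-map g z (f ∘ suc) n

spread₃-cong : ∀ (z : A) {f g} → (∀ q → f q ≡ g q) → ∀ n → spread₃ z f n ≡ spread₃ z g n
spread₃-cong z eq zero                = eq zero
spread₃-cong z eq (suc zero)          = refl
spread₃-cong z eq (suc (suc zero))    = refl
spread₃-cong z eq (suc (suc (suc n))) = spread₃-cong z (eq ∘ suc) n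

spread₃-divMod : ∀ (z : A) f n → spread₃ z f n ≡ (if n % 3 ≡ᵇ 0 then f (n / 3) else z)
spread₃-divMod z f zero                = refl
spread₃-divMod z f (suc zero)          = refl
spread₃-divMod z f (suc (suc zero))    = refl
spread₃-divMod z f (suc (suc (suc n))) =
  trans (spread₃-divMod z (f ∘ suc) n) (sym (cong₂ (λ m q → if m ≡ᵇ 0 then f q else z) mod-step div-step))
  where
  mod-step : suc (suc (suc n)) % 3 ≡ n % 3
  mod-step = trans (cong (_% 3) (+-comm 3 n)) ([m+n]%n≡m%n n 3)
  div-step : suc (suc (suc n)) / 3 ≡ suc (n / 3)
  div-step = m/n≡1+[m∸n]/n {suc (suc (suc n))} {3} (s≤s (s≤s (s≤s z≤n)))

aSeq-spread : ∀ N → aSeq N ≡ spread₃ 0 tilings N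
aSeq-spread zero    = refl
aSeq-spread (suc N) =
  trans (cong (λ t → if suc N % 3 ≡ᵇ 0 then t else 0) (tilingCount≡tilings (suc N / 3)))
        (sym (spread₃-divMod 0 tilings (suc N)))

mulPS-cong : ∀ p {A B : ℕ → ℤ} N → (∀ n → A n ≡ B n) → mulPS p A N ≡ mulPS p B N
mulPS-cong []            N eq = refl
mulPS-cong ((c , e) ∷ p) N eq =
  cong₂ ℤ._+_ (cong (λ a → if e ≤ᵇ N then c ℤ.* a else + 0) (eq (N ∸ e))) (mulPS-cong p N eq)

mulPS-zero : ∀ p N → mulPS p (λ _ → + 0) N ≡ + 0
mulPS-zero []            N = refl
mulPS-zero ((c , e) ∷ p) N with e ≤ᵇ N
... | true  = cong₂ ℤ._+_ (ℤ.*-zeroʳ c) (mulPS-zero p N)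
... | false = cong (λ x → + 0 ℤ.+ x) (mulPS-zero p N)

mulPS-+ : ∀ p (A B : ℕ → ℤ) N → mulPS p (λ n → A n ℤ.+ B n) N ≡ mulPS p A N ℤ.+ mulPS p B N
mulPS-+ []            A B N = refl
mulPS-+ ((c , e) ∷ p) A B N with e ≤ᵇ N
... | true  = begin
  c ℤ.* (A (N ∸ e) ℤ.+ B (N ∸ e)) ℤ.+ mulPS p (λ n → A n ℤ.+ B n) N
    ≡⟨ cong₂ ℤ._+_ (ℤ.*-distribˡ-+ c (A (N ∸ e)) (B (N ∸ e))) (mulPS-+ p A B N) ⟩
  (c ℤ.* A (N ∸ e) ℤ.+ c ℤ.* B (N ∸ e)) ℤ.+ (mulPS p A N ℤ.+ mulPS p B N)
    ≡⟨ ℤ-interchange (c ℤ.* A (N ∸ e)) (c ℤ.* B (N ∸ e)) (mulPS p A N) (mulPS p B N) ⟩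
  (c ℤ.* A (N ∸ e) ℤ.+ mulPS p A N) ℤ.+ (c ℤ.* B (N ∸ e) ℤ.+ mulPS p B N) ∎
  where open ≡-Reasoning
... | false = begin
  + 0 ℤ.+ mulPS p (λ n → A n ℤ.+ B n) N
    ≡⟨ ℤ.+-identityˡ (mulPS p (λ n → A n ℤ.+ B n) N) ⟩
  mulPS p (λ n → A n ℤ.+ B n) N
    ≡⟨ mulPS-+ p A B N ⟩
  mulPS p A N ℤ.+ mulPS p B N
    ≡⟨ cong₂ ℤ._+_ (ℤ.+-identityˡ (mulPS p A N)) (ℤ.+-identityˡ (mulPS p B N)) ⟨
  (+ 0 ℤ.+ mulPS p A N) ℤ.+ (+ 0 ℤ.+ mulPS p B N) ∎
  where open ≡-Reasoning

mulPS-sum≡0 : ∀ p (f : A → ℕ → ℕ) js N → (∀ {j} → j ∈ js → mulPS p (λ n → + f j n) N ≡ + 0) →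
  mulPS p (λ n → + sum (map (λ j → f j n) js)) N ≡ + 0
mulPS-sum≡0 p f []       N _    = mulPS-zero p N
mulPS-sum≡0 p f (j ∷ js) N none = begin
  mulPS p (λ n → + (f j n + sum (map (λ j → f j n) js))) N
    ≡⟨ mulPS-cong p N (λ n → ℤ.pos-+ (f j n) (sum (map (λ j → f j n) js))) ⟩
  mulPS p (λ n → + f j n ℤ.+ + sum (map (λ j → f j n) js)) N
    ≡⟨ mulPS-+ p (λ n → + f j n) (λ n → + sum (map (λ j → f j n) js)) N ⟩
  mulPS p (λ n → + f j n) N ℤ.+ mulPS p (λ n → + sum (map (λ j → f j n) js)) N
    ≡⟨ cong₂ ℤ._+_ (none (here refl)) (mulPS-sum≡0 p f js N (none ∘ there)) ⟩
  + 0 ∎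
  where open ≡-Reasoning

-- Every exponent of the denominator is at most 30, so for degrees from 30 on the shift is definitional.
denominator-shift : ∀ (A : ℕ → ℤ) M → mulPS denominator A (33 + M) ≡ mulPS denominator (λ n → A (3 + n)) (30 + M)
denominator-shift A M = refl

zeros : Vec ℕ 26
zeros = Vec.replicate 26 0

profileSeries : ℕ → Vec ℕ 26
profileSeries = spread₃ zeros counts

profileSeries-step : ∀ n → profileSeries (3 + n) ≡ transfer (profileSeries n)
profileSeries-step n = trans (spread₃-cong zeros counts-suc n) (sym (spread₃-map transfer zeros counts n))

opaque
  unfolding counts

  denominator-annihilates-initially : ∀ {M} → M < 3 → ∀ i → mulPS denominator (λ n → + Vec.lookup (profileSeries n) i) (30 + M) ≡ + 0
  denominator-annihilates-initially = toWitness {a? = allUpTo? (λ M → all? λ i → mulPS denominator (λ n → + Vec.lookup (profileSeries n) i) (30 + M) ℤ.≟ + 0) 3} _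

denominator-annihilates : ∀ M i → mulPS denominator (λ n → + Vec.lookup (profileSeries n) i) (30 + M) ≡ + 0
denominator-annihilates zero                i = denominator-annihilates-initially (s≤s z≤n) i
denominator-annihilates (suc zero)          i = denominator-annihilates-initially (s≤s (s≤s z≤n)) i
denominator-annihilates (suc (suc zero))    i = denominator-annihilates-initially (s≤s (s≤s (s≤s z≤n))) i
denominator-annihilates (suc (suc (suc M))) i = begin
  mulPS denominator (λ n → + Vec.lookup (profileSeries n) i) (33 + M)
    ≡⟨ denominator-shift (λ n → + Vec.lookup (profileSeries n) i) M ⟩
  mulPS denominator (λ n → + Vec.lookup (profileSeries (3 + n)) i) (30 + M)
    ≡⟨ mulPS-cong denominator (30 + M) (λ n → cong (λ v → + Vec.lookup v i) (profileSeries-step n)) ⟩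
  mulPS denominator (λ n → + Vec.lookup (transfer (profileSeries n)) i) (30 + M)
    ≡⟨ mulPS-cong denominator (30 + M) (λ n → cong +_ (lookup∘tabulate (λ j → sum (map (Vec.lookup (profileSeries n)) (Vec.lookup transitions j))) i)) ⟩
  mulPS denominator (λ n → + sum (map (λ j → Vec.lookup (profileSeries n) j) (Vec.lookup transitions i))) (30 + M)
    ≡⟨ mulPS-sum≡0 denominator (λ j n → Vec.lookup (profileSeries n) j) (Vec.lookup transitions i) (30 + M) (λ _ → denominator-annihilates M _) ⟩
  + 0 ∎
  where open ≡-Reasoning

tilingSeries : ℕ → ℤ
tilingSeries n = + spread₃ 0 tilings n

tilingSeries-shift : ∀ n → tilingSeries (3 + n) ≡ + Vec.lookup (profileSeries n) zero
tilingSeries-shift n = cong +_ (sym (spread₃-map (λ v → Vec.lookup v zero) zeros counts n))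

opaque
  unfolding counts

  early-coefficients : ∀ {N} → N < 33 → mulPS denominator tilingSeries N ≡ coeffP numerator N
  early-coefficients = toWitness {a? = allUpTo? (λ N → mulPS denominator tilingSeries N ℤ.≟ coeffP numerator N) 33} _

  tilings-values : tilings 2 ≡ 29 × tilings 4 ≡ 1065 × tilings 6 ≡ 41097
  tilings-values = refl , refl , refl

late-coefficients : ∀ M → mulPS denominator tilingSeries (33 + M) ≡ coeffP numerator (33 + M)
late-coefficients M = begin
  mulPS denominator tilingSeries (33 + M)                                ≡⟨ denominator-shift tilingSeries M ⟩
  mulPS denominator (λ n → tilingSeries (3 + n)) (30 + M)                ≡⟨ mulPS-cong denominator (30 + M) tilingSeries-shift ⟩
  mulPS denominator (λ n → + Vec.lookup (profileSeries n) zero) (30 + M) ≡⟨ denominator-annihilates M zero ⟩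
  + 0                                                                    ∎
  where open ≡-Reasoning

split-at : ∀ k N → N < k ⊎ ∃ λ M → N ≡ k + M
split-at zero    N       = inj₂ (N , refl)
split-at (suc k) zero    = inj₁ z<s
split-at (suc k) (suc N) with split-at k N
... | inj₁ N<k      = inj₁ (s<s N<k)
... | inj₂ (M , eq) = inj₂ (M , cong suc eq)

tilingSeries-generatingFunction : ∀ N → mulPS denominator tilingSeries N ≡ coeffP numerator N
tilingSeries-generatingFunction N with split-at 33 N
... | inj₁ N<33       = early-coefficients N<33
... | inj₂ (M , refl) = late-coefficients M

mainTheorem16 : ((N : ℕ) → mulPS denominator (λ n → + aSeq n) N ≡ coeffP numerator N)
    × (aSeq 0 ≡ 1) × (aSeq 6 ≡ 29) × (aSeq 12 ≡ 1065) × (aSeq 18 ≡ 41097)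
mainTheorem16 =
  (λ N → trans (mulPS-cong denominator N (cong +_ ∘ aSeq-spread)) (tilingSeries-generatingFunction N)) ,
  refl ,
  trans (aSeq-spread 6) (proj₁ tilings-values) ,
  trans (aSeq-spread 12) (proj₁ (proj₂ tilings-values)) ,
  trans (aSeq-spread 18) (proj₂ (proj₂ tilings-values))
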